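{- Let $\mathbf{C}:\mathcal{C}\to\mathcal{B}$ be a fibration and let $g:C\to D$ and $k:B\to D$ be morphisms in $\mathcal{B}$. If for every $P\in\mathrm{Ob}\,\mathcal{C}^C$ there is a cocartesian lift of $g$ with domain $P$ that is stable along $k$, then every $\prod$-diagram over $k$ is stable along $g$.
   Context: For a functor $\mathbf{C}:\mathcal{C}\to\mathcal{B}$: objects/morphisms lie over their images; the fiber $\mathcal{C}^A$ has objects over $A$ and morphisms over $\mathrm{id}_A$. A morphism $q:Q\to R$ over $g$ is cartesian if every $r:P\to R$ over $gf$ factors uniquely as $qp$ with $p$ over $f$; cocartesian is dual. $\mathbf{C}$ is a fibration if cartesian lifts with any given codomain exist. $\prod$-diagram: for $f:X\to Y$ and $P\in\mathcal{C}^X$, a $\prod$-diagram over $f$ based on $P$ is a cartesian $c:f^*R\to R$ over $f$ with $\varepsilon:f^*R\to P$ in $\mathcal{C}^X$ such that for every cartesian $c':S\to Q$ over $f$ and every $p:S\to P$ in $\mathcal{C}^X$ there is a unique $\tilde p:Q\to R$ in $\mathcal{C}^Y$ with $\varepsilon\circ u=p$, where $u:S\to f^*R$ is the unique morphism over $\mathrm{id}_X$ with $cu=\tilde pc'$. Stability: for a pullback square in $\mathcal{B}$ with $f:A\to B$, $h:A\to C$, $gh=kf$: a cocartesian $t:P\to S$ over $g$ is stable along $k$ if for every such square and all cartesian lifts $h^*P\to P$ over $h$ and $k^*S\to S$ over $k$, the induced morphism $h^*P\to k^*S$ over $f$ is cocartesian. A $\prod$-diagram $(c:k^*R\to R,\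 \varepsilon:k^*R\to Q)$ over $k$ is stable along $g$ if for every such square and all cartesian lifts over $f$ of $k^*R$ and of $Q$ and over $g$ of $R$, the pair (induced morphism $f^*k^*R\to g^*R$ over $h$, induced morphism $f^*\varepsilon:f^*k^*R\to f^*Q$ over $\mathrm{id}_A$) is a $\prod$-diagram over $h$ based on $f^*Q$. -}

module Defs where

open import Level using (Level; _⊔_) renaming (suc to lsuc)
open import Data.Product using (Σ; Σ-syntax; _×_; _,_)
open import Relation.Binary.PropositionalEquality using (_≡_)

∃!′ : ∀ {a p} (A : Set a) → (A → Set p) → Set (a ⊔ p)
∃!′ A P = Σ A λ x → P x × (∀ y → P y → x ≡ y)

record Category (o ℓ : Level) : Set (lsuc (o ⊔ ℓ)) where
  infixr 9 _∘_
  field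
    Obj  : Set o
    Hom  : Obj → Obj → Set ℓ
    id   : ∀ {A} → Hom A A
    _∘_  : ∀ {A B C} → Hom B C → Hom A B → Hom A C
    assoc : ∀ {A B C D} {f : Hom A B} {g : Hom B C} {h : Hom C D} →
            (h ∘ g) ∘ f ≡ h ∘ (g ∘ f)
    identityˡ : ∀ {A B} {f : Hom A B} → id ∘ f ≡ f
    identityʳ : ∀ {A B} {f : Hom A B} → f ∘ id ≡ f

record Functor {o ℓ o' ℓ'} (𝒞 : Category o ℓ) (ℬ : Category o' ℓ')
       : Set (o ⊔ ℓ ⊔ o' ⊔ ℓ') where
  private
    module C = Category 𝒞
    module B = Category ℬ
  field
    F₀ : C.Obj → B.Obj
    F₁ : ∀ {X Y} → C.Hom X Y → B.Hom (F₀ X) (F₀ Y)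
    identity : ∀ {X} → F₁ (C.id {X}) ≡ B.id
    homomorphism : ∀ {X Y Z} {f : C.Hom X Y} {g : C.Hom Y Z} →
                   F₁ (g C.∘ f) ≡ F₁ g B.∘ F₁ f

-- Pullback squares in ℬ:
--        h
--    A ----> C
--  f |       | g
--    v       v
--    B ----> D
--        k
module _ {o ℓ} (ℬ : Category o ℓ) where
  open Category ℬ
  IsPullback : ∀ {A B C D} (f : Hom A B) (h : Hom A C) (g : Hom C D) (k : Hom B D)
             → Set (o ⊔ ℓ)
  IsPullback {A} {B} {C} {D} f h g k =
    (g ∘ h ≡ k ∘ f) ×
    (∀ {Z} (x : Hom Z C) (y : Hom Z B) → g ∘ x ≡ k ∘ y →
       ∃!′ (Hom Z A) λ u → (h ∘ u ≡ x) × (f ∘ u ≡ y))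

module Fib {o ℓ o' ℓ'} {𝒞 : Category o ℓ} {ℬ : Category o' ℓ'}
           (𝐂 : Functor 𝒞 ℬ) where
  private
    module C = Category 𝒞
    module B = Category ℬ
  open Functor 𝐂

  private
    L : Level
    L = o ⊔ ℓ ⊔ o' ⊔ ℓ'

  Over : ∀ {P Q} (q : C.Hom P Q) {X Y} (g : B.Hom X Y) → Set (o' ⊔ ℓ')
  Over {P} {Q} q {X} {Y} g =
    _≡_ {A = Σ B.Obj λ U → Σ B.Obj λ V → B.Hom U V}
        (F₀ P , F₀ Q , F₁ q) (X , Y , g)

  InFiber : C.Obj → B.Obj → Set o'
  InFiber P X = F₀ P ≡ X

  IsCartesian : ∀ {Q R} (q : C.Hom Q R) {X Y} (g : B.Hom X Y) → Set L
  IsCartesian {Q} {R} q {X} {Y} g =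
    Over q g ×
    (∀ {W P} (f : B.Hom W X) (r : C.Hom P R) → Over r (g B.∘ f) →
       ∃!′ (C.Hom P Q) λ p → Over p f × (q C.∘ p ≡ r))

  IsCocartesian : ∀ {P S} (t : C.Hom P S) {X Y} (g : B.Hom X Y) → Set L
  IsCocartesian {P} {S} t {X} {Y} g =
    Over t g ×
    (∀ {W R} (f : B.Hom Y W) (r : C.Hom P R) → Over r (f B.∘ g) →
       ∃!′ (C.Hom S R) λ s → Over s f × (s C.∘ t ≡ r))

  IsFibration : Set L
  IsFibration = ∀ {X Y} (g : B.Hom X Y) (R : C.Obj) → InFiber R Y →
    Σ C.Obj λ Q → Σ (C.Hom Q R) λ q → IsCartesian q g

  -- (c : f*R → R , ε : f*R → P) is a ∏-diagram over f : X → Y based on P.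
  -- The morphism u of the definition (unique over id_X with c∘u = p̃∘c',
  -- which exists since c is cartesian) is referred to by quantifying over
  -- all morphisms with its defining property.
  IsΠDiagram : ∀ {fR R P} (c : C.Hom fR R) (ε : C.Hom fR P)
               {X Y} (f : B.Hom X Y) → Set L
  IsΠDiagram {fR} {R} {P} c ε {X} {Y} f =
    IsCartesian c f ×
    Over ε (B.id {X}) ×
    (∀ {S Q} (c' : C.Hom S Q) → IsCartesian c' f →
     ∀ (p : C.Hom S P) → Over p (B.id {X}) →
       ∃!′ (C.Hom Q R) λ p̃ → Over p̃ (B.id {Y}) ×
         (∀ (u : C.Hom S fR) → Over u (B.id {X}) → c C.∘ u ≡ p̃ C.∘ c' →
            ε C.∘ u ≡ p))

  CocartStableAlong : ∀ {P S} (t : C.Hom P S) {Cb D Bb}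
                      (g : B.Hom Cb D) (k : B.Hom Bb D) → Set L
  CocartStableAlong {P} {S} t {Cb} {D} {Bb} g k =
    ∀ {A} (f : B.Hom A Bb) (h : B.Hom A Cb) → IsPullback ℬ f h g k →
    ∀ {hP} (ch : C.Hom hP P) → IsCartesian ch h →
    ∀ {kS} (ck : C.Hom kS S) → IsCartesian ck k →
    ∀ (m : C.Hom hP kS) → Over m f → ck C.∘ m ≡ t C.∘ ch →
      IsCocartesian m f

  ΠStableAlong : ∀ {kR R Q} (c : C.Hom kR R) (ε : C.Hom kR Q)
                 {Bb D Cb} (k : B.Hom Bb D) (g : B.Hom Cb D) → Set L
  ΠStableAlong {kR} {R} {Q} c ε {Bb} {D} {Cb} k g =
    ∀ {A} (f : B.Hom A Bb) (h : B.Hom A Cb) → IsPullback ℬ f h g k →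
    ∀ {fkR} (c₁ : C.Hom fkR kR) → IsCartesian c₁ f →
    ∀ {fQ} (c₂ : C.Hom fQ Q) → IsCartesian c₂ f →
    ∀ {gR} (c₃ : C.Hom gR R) → IsCartesian c₃ g →
    ∀ (m : C.Hom fkR gR) → Over m h → c₃ C.∘ m ≡ c C.∘ c₁ →
    ∀ (n : C.Hom fkR fQ) → Over n (B.id {A}) → c₂ C.∘ n ≡ ε C.∘ c₁ →
      IsΠDiagram m n h

-- The induced m is cartesian since c₃ ∘ m = c ∘ c₁ is cartesian over g ∘ h = k ∘ f. For the
-- universal property against a cartesian d : S → Q' over h, take a stable cocartesian
-- t : Q' → T over g and a cartesian ck : k*T → T; stability makes the induced m' : S → k*T
-- cocartesian over f. A cartesian morphism and a cocartesian one over the same base map set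
-- up a bijection of vertical maps (x ↦ y with q ∘ x = y ∘ e). Via t and c₃, vertical maps
-- Q' → g*R correspond to vertical maps T → R; via m' and c₁, vertical maps S → f*k*R to
-- vertical maps k*T → k*R. Under these bijections the universal property of (m , n) at d
-- becomes that of the ∏-diagram (c , ε) at ck.
module Submission where

open import Defs
open import Level using (Level)
open import Data.Product using (Σ; _×_; _,_; proj₁; proj₂)
open import Function.Bundles using (_⇔_; mk⇔; Equivalence)
open import Relation.Binary.PropositionalEquality

module Fibred {o ℓ o' ℓ'} {𝒞 : Category o ℓ} {ℬ : Category o' ℓ'} (𝐂 : Functor 𝒞 ℬ)
  where
  private
    module C = Category 𝒞
    module B = Category ℬ
  open C using (_∘_)
  open Functor 𝐂
  open Fib 𝐂

  paste : ∀ {U V W X Y Z} {a : C.Hom Y Z} {b : C.Hom W Y} {c : C.Hom X Z} {d : C.Hom W X}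
          {e : C.Hom U W} {f : C.Hom V X} {g : C.Hom U V} →
          a ∘ b ≡ c ∘ d → d ∘ e ≡ f ∘ g → a ∘ (b ∘ e) ≡ (c ∘ f) ∘ g
  paste {a = a} {b} {c} {d} {e} {f} {g} ab≡cd de≡fg = begin
    a ∘ (b ∘ e)   ≡⟨ C.assoc ⟨
    (a ∘ b) ∘ e   ≡⟨ cong (_∘ e) ab≡cd ⟩
    (c ∘ d) ∘ e   ≡⟨ C.assoc ⟩
    c ∘ (d ∘ e)   ≡⟨ cong (c ∘_) de≡fg ⟩
    c ∘ (f ∘ g)   ≡⟨ C.assoc ⟨
    (c ∘ f) ∘ g   ∎
    where open ≡-Reasoning

  Over-resp : ∀ {P Q} {q : C.Hom P Q} {X Y} {g g' : B.Hom X Y} →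
              Over q g → g ≡ g' → Over q g'
  Over-resp q-over refl = q-over

  Over-∘ : ∀ {P Q R} {q : C.Hom Q R} {p : C.Hom P Q} {X Y Z} {g : B.Hom Y Z} {f : B.Hom X Y} →
           Over q g → Over p f → Over (q ∘ p) (g B.∘ f)
  Over-∘ refl refl = cong (λ u → _ , _ , u) homomorphism

  Over-∘-vertical : ∀ {P Q R} {q : C.Hom Q R} {v : C.Hom P Q} {Y Z} {g : B.Hom Y Z} →
                    Over q g → Over v (B.id {Y}) → Over (q ∘ v) g
  Over-∘-vertical q-over v-over = Over-resp (Over-∘ q-over v-over) B.identityʳ

  Over-vertical-∘ : ∀ {P Q R} {v : C.Hom Q R} {q : C.Hom P Q} {Y Z} {g : B.Hom Y Z} →
                    Over v (B.id {Z}) → Over q g → Over (v ∘ q) g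
  Over-vertical-∘ v-over q-over = Over-resp (Over-∘ v-over q-over) B.identityˡ

  Over-codomain : ∀ {P Q} {q : C.Hom P Q} {X Y} {g : B.Hom X Y} → Over q g → InFiber Q Y
  Over-codomain q-over = cong (λ u → proj₁ (proj₂ u)) q-over

  cartesian-factor : ∀ {Q R P} {q : C.Hom Q R} {X Y} {g : B.Hom X Y} → IsCartesian q g →
                     ∀ {r : C.Hom P R} → Over r g →
                     Σ (C.Hom P Q) λ p → Over p (B.id {X}) × q ∘ p ≡ r
  cartesian-factor (_ , factor) {r} r-over =
    let p , p-factors , _ = factor B.id r (Over-resp r-over (sym B.identityʳ)) in p , p-factors

  cocartesian-factor : ∀ {P S R} {t : C.Hom P S} {X Y} {g : B.Hom X Y} → IsCocartesian t g →
                       ∀ {r : C.Hom P R} → Over r g →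
                       Σ (C.Hom S R) λ s → Over s (B.id {Y}) × s ∘ t ≡ r
  cocartesian-factor (_ , factor) {r} r-over =
    let s , s-factors , _ = factor B.id r (Over-resp r-over (sym B.identityˡ)) in s , s-factors

  cartesian-monic : ∀ {Q R} {q : C.Hom Q R} {X Y} {g : B.Hom X Y} → IsCartesian q g →
                    ∀ {W P} {f : B.Hom W X} {x y : C.Hom P Q} → Over x f → Over y f →
                    q ∘ x ≡ q ∘ y → x ≡ y
  cartesian-monic (q-over , factor) {f = f} {x} {y} x-over y-over qx≡qy =
    let _ , _ , unique = factor f (_ ∘ y) (Over-∘ q-over y-over)
    in trans (sym (unique x (x-over , qx≡qy))) (unique y (y-over , refl))

  cocartesian-epic : ∀ {P S} {t : C.Hom P S} {X Y} {g : B.Hom X Y} → IsCocartesian t g →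
                     ∀ {W R} {f : B.Hom Y W} {x y : C.Hom S R} → Over x f → Over y f →
                     x ∘ t ≡ y ∘ t → x ≡ y
  cocartesian-epic (t-over , factor) {f = f} {x} {y} x-over y-over xt≡yt =
    let _ , _ , unique = factor f (y ∘ _) (Over-∘ y-over t-over)
    in trans (sym (unique x (x-over , xt≡yt))) (unique y (y-over , refl))

  cartesian-cocartesian-cancel :
    ∀ {P Q R S} {q : C.Hom Q R} {e : C.Hom P S} {X Y X' Y' Z Z'}
      {g : B.Hom X Y} {f : B.Hom X' Y'} {a : B.Hom Z X} {b : B.Hom Y' Z'} →
    IsCartesian q g → IsCocartesian e f →
    ∀ {x y : C.Hom P Q} {x' y' : C.Hom S R} →
    Over x a → Over y a → Over x' b → Over y' b →
    q ∘ x ≡ x' ∘ e → q ∘ y ≡ y' ∘ e → (x ≡ y ⇔ x' ≡ y')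
  cartesian-cocartesian-cancel {q = q} {e} q-cart e-cocart x-over y-over x'-over y'-over qx qy =
    mk⇔ (λ x≡y → cocartesian-epic e-cocart x'-over y'-over
                   (trans (sym qx) (trans (cong (q ∘_) x≡y) qy)))
        (λ x'≡y' → cartesian-monic q-cart x-over y-over
                   (trans qx (trans (cong (_∘ e) x'≡y') (sym qy))))

  cartesian-∘ : ∀ {P Q R} {q : C.Hom Q R} {p : C.Hom P Q} {X Y Z} {g : B.Hom Y Z}
                {f : B.Hom X Y} →
                IsCartesian q g → IsCartesian p f → IsCartesian (q ∘ p) (g B.∘ f)
  cartesian-∘ {q = q} {p} {g = g} {f} (q-over , q-factor) (p-over , p-factor) =
    Over-∘ q-over p-over , factor
    where
    factor : ∀ {W P'} (f' : B.Hom W _) (r : C.Hom P' _) → Over r ((g B.∘ f) B.∘ f') →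
             ∃!′ (C.Hom P' _) λ b → Over b f' × (q ∘ p) ∘ b ≡ r
    factor f' r r-over =
      let a , (a-over , qa≡r) , a-unique = q-factor (f B.∘ f') r (Over-resp r-over B.assoc)
          b , (b-over , pb≡a) , b-unique = p-factor f' a a-over
      in b , (b-over , trans C.assoc (trans (cong (q ∘_) pb≡a) qa≡r)) ,
         λ b' (b'-over , qpb'≡r) → b-unique b' (b'-over , sym (a-unique (p ∘ b')
           (Over-∘ p-over b'-over , trans (sym C.assoc) qpb'≡r)))

  cartesian-cancelˡ : ∀ {P Q R} {q : C.Hom Q R} {m : C.Hom P Q} {X Y Z} {g : B.Hom Y Z}
                      {h : B.Hom X Y} →
                      IsCartesian q g → Over m h → IsCartesian (q ∘ m) (g B.∘ h) →
                      IsCartesian m h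
  cartesian-cancelˡ {q = q} {m} {g = g} {h} q-cart@(q-over , _) m-over (_ , qm-factor) =
    m-over , factor
    where
    factor : ∀ {W P'} (f' : B.Hom W _) (r : C.Hom P' _) → Over r (h B.∘ f') →
             ∃!′ (C.Hom P' _) λ b → Over b f' × m ∘ b ≡ r
    factor f' r r-over =
      let b , (b-over , qmb≡qr) , b-unique =
            qm-factor f' (q ∘ r) (Over-resp (Over-∘ q-over r-over) (sym B.assoc))
      in b , (b-over , cartesian-monic q-cart (Over-∘ m-over b-over) r-over
                         (trans (sym C.assoc) qmb≡qr)) ,
         λ b' (b'-over , mb'≡r) → b-unique b' (b'-over , trans C.assoc (cong (q ∘_) mb'≡r))

  ΠMediates : ∀ {fR R P S Q} (c : C.Hom fR R) (ε : C.Hom fR P) (c' : C.Hom S Q)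
              (p : C.Hom S P) (p̃ : C.Hom Q R) {X} → Set _
  ΠMediates c ε c' p p̃ {X} =
    ∀ (u : C.Hom _ _) → Over u (B.id {X}) → c ∘ u ≡ p̃ ∘ c' → ε ∘ u ≡ p

  module PulledBackΠ
    {Bb D Cb A} {k : B.Hom Bb D} {g : B.Hom Cb D} {f : B.Hom A Bb} {h : B.Hom A Cb}
    (square : g B.∘ h ≡ k B.∘ f)
    {kR R Q} {c : C.Hom kR R} {ε : C.Hom kR Q} (Π : IsΠDiagram c ε k)
    {fkR} {c₁ : C.Hom fkR kR} (c₁-cart : IsCartesian c₁ f)
    {fQ} {c₂ : C.Hom fQ Q} (c₂-cart : IsCartesian c₂ f)
    {gR} {c₃ : C.Hom gR R} (c₃-cart : IsCartesian c₃ g)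
    {m : C.Hom fkR gR} (m-over : Over m h) (m-square : c₃ ∘ m ≡ c ∘ c₁)
    {n : C.Hom fkR fQ} (n-over : Over n (B.id {A})) (n-square : c₂ ∘ n ≡ ε ∘ c₁)
    where

    private
      c-cart : IsCartesian c k
      c-cart = proj₁ Π

      ε-over : Over ε (B.id {Bb})
      ε-over = proj₁ (proj₂ Π)

    m-cartesian : IsCartesian m h
    m-cartesian = cartesian-cancelˡ c₃-cart m-over
      (subst₂ (λ q b → IsCartesian q b) (sym m-square) (sym square)
              (cartesian-∘ c-cart c₁-cart))

    module _ {S Q'} {d : C.Hom S Q'} (d-cart : IsCartesian d h)
             {T} {t : C.Hom Q' T} (t-cocart : IsCocartesian t g)
             {kT} {ck : C.Hom kT T} (ck-cart : IsCartesian ck k)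
             {m' : C.Hom S kT} (m'-cocart : IsCocartesian m' f) (m'-square : ck ∘ m' ≡ t ∘ d)
             where

      mediates-transfer :
        ∀ {p : C.Hom S fQ} {p' : C.Hom kT Q} → Over p (B.id {A}) → Over p' (B.id {Bb}) →
        p' ∘ m' ≡ c₂ ∘ p →
        ∀ {p̃ : C.Hom Q' gR} {r : C.Hom T R} → Over p̃ (B.id {Cb}) → Over r (B.id {D}) →
        c₃ ∘ p̃ ≡ r ∘ t →
        ΠMediates m n d p p̃ ⇔ ΠMediates c ε ck p' r
      mediates-transfer {p} {p'} p-over p'-over p'-square {p̃} {r} p̃-over r-over p̃-square =
        mk⇔ (λ mediates w w-over cw≡rck →
               let u , u-over , c₁u≡wm' =
                     cartesian-factor c₁-cart (Over-vertical-∘ w-over (proj₁ m'-cocart))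
               in Equivalence.to (ε-side u-over w-over c₁u≡wm')
                    (mediates u u-over
                      (Equivalence.from (c-side u-over w-over c₁u≡wm') cw≡rck)))
            (λ mediates u u-over mu≡p̃d →
               let w , w-over , wm'≡c₁u =
                     cocartesian-factor m'-cocart (Over-∘-vertical (proj₁ c₁-cart) u-over)
               in Equivalence.from (ε-side u-over w-over (sym wm'≡c₁u))
                    (mediates w w-over
                      (Equivalence.to (c-side u-over w-over (sym wm'≡c₁u)) mu≡p̃d)))
        where
        c-side : ∀ {u w} → Over u (B.id {A}) → Over w (B.id {Bb}) → c₁ ∘ u ≡ w ∘ m' →
                 (m ∘ u ≡ p̃ ∘ d) ⇔ (c ∘ w ≡ r ∘ ck)
        c-side u-over w-over c₁u≡wm' = cartesian-cocartesian-cancel c₃-cart m'-cocart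
          (Over-∘-vertical m-over u-over) (Over-vertical-∘ p̃-over (proj₁ d-cart))
          (Over-∘-vertical (proj₁ c-cart) w-over) (Over-vertical-∘ r-over (proj₁ ck-cart))
          (paste m-square c₁u≡wm') (paste p̃-square (sym m'-square))

        ε-side : ∀ {u w} → Over u (B.id {A}) → Over w (B.id {Bb}) → c₁ ∘ u ≡ w ∘ m' →
                 (n ∘ u ≡ p) ⇔ (ε ∘ w ≡ p')
        ε-side u-over w-over c₁u≡wm' = cartesian-cocartesian-cancel c₂-cart m'-cocart
          (Over-∘-vertical n-over u-over) p-over (Over-∘-vertical ε-over w-over) p'-over
          (paste n-square c₁u≡wm') (sym p'-square)

      universal : ∀ (p : C.Hom S fQ) → Over p (B.id {A}) →
                  ∃!′ (C.Hom Q' gR) λ p̃ → Over p̃ (B.id {Cb}) × ΠMediates m n d p p̃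
      universal p p-over
        with cocartesian-factor m'-cocart (Over-∘-vertical (proj₁ c₂-cart) p-over)
      ... | p' , p'-over , p'-square
        with proj₂ (proj₂ Π) ck ck-cart p' p'-over
      ... | r , (r-over , r-mediates) , r-unique
        with cartesian-factor c₃-cart (Over-vertical-∘ r-over (proj₁ t-cocart))
      ... | p̃ , p̃-over , p̃-square =
        p̃ , (p̃-over , Equivalence.from (transfer p̃-over r-over p̃-square) r-mediates) , unique
        where
        transfer : ∀ {p̃ : C.Hom Q' gR} {r : C.Hom T R} → Over p̃ (B.id {Cb}) →
                   Over r (B.id {D}) → c₃ ∘ p̃ ≡ r ∘ t →
                   ΠMediates m n d p p̃ ⇔ ΠMediates c ε ck p' r
        transfer = mediates-transfer p-over p'-over p'-square

        unique : ∀ p̃₂ → Over p̃₂ (B.id {Cb}) × ΠMediates m n d p p̃₂ → p̃ ≡ p̃₂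
        unique p̃₂ (p̃₂-over , p̃₂-mediates) =
          let r₂ , r₂-over , r₂t≡c₃p̃₂ =
                cocartesian-factor t-cocart (Over-∘-vertical (proj₁ c₃-cart) p̃₂-over)
              r≡r₂ = r-unique r₂ (r₂-over ,
                       Equivalence.to (transfer p̃₂-over r₂-over (sym r₂t≡c₃p̃₂)) p̃₂-mediates)
          in cartesian-monic c₃-cart p̃-over p̃₂-over
               (trans p̃-square (trans (cong (_∘ t) r≡r₂) r₂t≡c₃p̃₂))

proposition3p1p11 :
  ∀ {o ℓ o' ℓ' : Level} {𝒞 : Category o ℓ} {ℬ : Category o' ℓ'}
    (𝐂 : Functor 𝒞 ℬ) → Fib.IsFibration 𝐂 →
  ∀ {Cb Bb D : Category.Obj ℬ}
    (g : Category.Hom ℬ Cb D) (k : Category.Hom ℬ Bb D) →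
  (∀ (P : Category.Obj 𝒞) → Fib.InFiber 𝐂 P Cb →
     Σ (Category.Obj 𝒞) λ S → Σ (Category.Hom 𝒞 P S) λ t →
       Fib.IsCocartesian 𝐂 t g × Fib.CocartStableAlong 𝐂 t g k) →
  ∀ {kR R Q : Category.Obj 𝒞}
    (c : Category.Hom 𝒞 kR R) (ε : Category.Hom 𝒞 kR Q) →
    Fib.IsΠDiagram 𝐂 c ε k → Fib.ΠStableAlong 𝐂 c ε k g
proposition3p1p11 {𝒞 = 𝒞} 𝐂 fibration g k stable-lifts c ε Π
                  f h pullback c₁ c₁-cart c₂ c₂-cart c₃ c₃-cart m m-over m-square n n-over n-square =
  m-cartesian , n-over , λ d d-cart →
    let T , t , t-cocart , t-stable = stable-lifts _ (Over-codomain (proj₁ d-cart))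
        _ , ck , ck-cart = fibration k T (Over-codomain (proj₁ t-cocart))
        m' , (m'-over , m'-square) , _ = proj₂ ck-cart f (t ∘ d)
          (Over-resp (Over-∘ (proj₁ t-cocart) (proj₁ d-cart)) (proj₁ pullback))
        m'-cocart = t-stable f h pullback d d-cart ck ck-cart m' m'-over m'-square
    in universal d-cart t-cocart ck-cart m'-cocart m'-square
  where
  open Category 𝒞 using (_∘_)
  open Fibred 𝐂
  open PulledBackΠ (proj₁ pullback) Π c₁-cart c₂-cart c₃-cart m-over m-square n-over n-square
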